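{- For every $k\ge1$, the rubbling number of the odd cycle is $\rho(C_{2k+1})=\left\lfloor\frac{7\cdot 2^{k-1}-2}{3}\right\rfloor+1$.
   Context: A pebble distribution on a graph $G$ is a function $p:V(G)\to\mathbb{Z}_{\ge0}$, its size is $\sum_v p(v)$. If $\{v,u\}\in E(G)$, the pebbling move $(v,v\to u)$ removes two pebbles at $v$ and adds one at $u$. If $v\ne w$ and $\{v,u\},\{w,u\}\in E(G)$, the strict rubbling move $(v,w\to u)$ removes one pebble at each of $v$ and $w$ and adds one at $u$. A rubbling move is either of these. A vertex $x$ is reachable from $p$ if there is a sequence of rubbling moves, with pebble counts never becoming negative, after which $x$ has at least one pebble. The rubbling number $\rho(G)$ is the minimum $m$ such that every vertex of $G$ is reachable from every pebble distribution of size $m$. -}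

module Defs where

open import Data.Nat using (ℕ; zero; suc; _+_; _*_; _∸_; _^_; _≤_; _%_; _/_)
open import Data.Nat.ListAction using (sum)
open import Data.Fin using (Fin; toℕ; _≟_)
open import Data.List using (map; allFin)
open import Data.Bool using (if_then_else_)
open import Data.Product using (_×_; ∃)
open import Data.Sum using (_⊎_)
open import Relation.Nullary using (¬_; does)
open import Relation.Binary.PropositionalEquality using (_≡_)
open import Relation.Binary.Construct.Closure.ReflexiveTransitive using (Star)

record Graph : Set₁ where
  field
    n   : ℕ
    Adj : Fin n → Fin n → Set
open Graph public

Dist : Graph → Set
Dist G = Fin (n G) → ℕ

size : (G : Graph) → Dist G → ℕ
size G p = sum (map p (allFin (n G)))

pt : ∀ {m} → Fin m → ℕ → Fin m → ℕ
pt v c x = if does (x ≟ v) then c else 0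

data Move (G : Graph) (p : Dist G) : Dist G → Set where
  pebbling : (v u : Fin (n G)) → Adj G v u → 2 ≤ p v →
    Move G p (λ x → (p x ∸ pt v 2 x) + pt u 1 x)
  strict : (v w u : Fin (n G)) → ¬ (v ≡ w) → Adj G v u → Adj G w u →
    1 ≤ p v → 1 ≤ p w →
    Move G p (λ x → ((p x ∸ pt v 1 x) ∸ pt w 1 x) + pt u 1 x)

Reachable : (G : Graph) → Dist G → Fin (n G) → Set
Reachable G p x = ∃ λ q → Star (Move G) p q × 1 ≤ q x

Solvable : Graph → ℕ → Set
Solvable G m = (p : Dist G) → size G p ≡ m → (x : Fin (n G)) → Reachable G p x

IsRubblingNumber : Graph → ℕ → Set
IsRubblingNumber G r = Solvable G r × ((m : ℕ) → Solvable G m → r ≤ m)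

-- cycle C_m on vertices 0..m-1: i ~ j iff they differ by 1, or {i,j} = {0, m-1}
-- (used for m ≥ 3)
Cycle : ℕ → Graph
Cycle m = record
  { n = m
  ; Adj = λ i j → (suc (toℕ i) ≡ toℕ j) ⊎ (suc (toℕ j) ≡ toℕ i)
                ⊎ (toℕ i ≡ 0 × suc (toℕ j) ≡ m) ⊎ (toℕ j ≡ 0 × suc (toℕ i) ≡ m) }

module Submission where

-- Put the target at vertex 0 and call 1 … k and 2k … k + 1 its two branches; vertex k
-- and k + 1 form the far edge.  Weight a pebble at distance j along a branch by 2^(k−j),
-- so that one pebble next to the target is worth H = 2^(k−1).
--
-- Lower bound: no rubbling move increases either branch weight, except a pebbling move
-- across the far edge, which costs 2 on one side and gains 1 on the other.  Starting from
-- A pebbles on k and B on k + 1, the invariant X + 2s ≤ A + t, Y + 2t ≤ B + s therefore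
-- survives every move, and for F = ⌊(7H − 2)/3⌋ = A + B it rules out the weights (2H on one
-- branch, or H on both) that a move onto the target needs.
--
-- Upper bound: every vertex other than the target counts at least twice in the sum of the
-- two branch weights plus the far-edge pebbles, so m pebbles give X + Y + q(k) + q(k+1) ≥ 2m.
-- When 7H ≤ 3m + 1, pebbling a suitable number of pebbles across the far edge balances the
-- branches to weights (2H, ·) or (H, H); pebbling down a branch then delivers 2 or 1 pebbles
-- next to the target, and a final move reaches it.  Rotating the cycle moves any target to 0.

open import Defs
open import Data.Empty using (⊥; ⊥-elim)
open import Data.Fin using (Fin; zero; suc; toℕ; fromℕ; fromℕ<; inject₁; lower₁; _≟_)
open import Data.Fin.Properties
  using ( toℕ-injective; toℕ-fromℕ; toℕ-fromℕ<; toℕ-inject₁; toℕ-lower₁; inject₁-lower₁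
        ; toℕ<n; toℕ≤pred[n] )
open import Data.List using (tabulate; _∷_; [])
open import Data.List.Properties using (map-tabulate)
import Data.Nat.ListAction as List
open import Data.Nat
  using (ℕ; zero; suc; _+_; _*_; _∸_; _^_; _≤_; _<_; _/_; _⊓_; z≤n; s≤s; s≤s⁻¹; _≤?_; _<?_)
  renaming (_≟_ to _≟ℕ_)
open import Data.Nat.DivMod using (m≡m%n+[m/n]*n; m%n<n; m/n*n≤m)
open import Data.Nat.Properties hiding (_≟_)
open import Data.Nat.Tactic.RingSolver using (solve)
open import Algebra.Properties.Semiring.Sum +-*-semiring
  using (sum; sum-cong-≗; ∑-distrib-+; *-distribˡ-sum; *-distribʳ-sum; sum-init-last; sum-replicate-zero)
open import Algebra.Properties.CommutativeSemigroup +-commutativeSemigroup using (xy∙z≈xz∙y)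
import Algebra.Properties.CommutativeSemigroup *-commutativeSemigroup as *-Semigroup
open import Data.Product using (_×_; _,_; ∃; proj₁; proj₂)
open import Data.Sum using (_⊎_; inj₁; inj₂)
open import Function using (_∘_; _$_)
open import Relation.Binary.Construct.Closure.ReflexiveTransitive using (Star; ε; _◅_; _◅◅_)
open import Relation.Binary.Definitions using (tri<; tri≈; tri>)
open import Relation.Binary.PropositionalEquality
open import Relation.Nullary using (¬_; yes; no)

sum-mono-≤ : ∀ {m} {f g : Fin m → ℕ} → (∀ y → f y ≤ g y) → sum f ≤ sum g
sum-mono-≤ {zero}  f≤g = z≤n
sum-mono-≤ {suc m} f≤g = +-mono-≤ (f≤g zero) (sum-mono-≤ (f≤g ∘ suc))

term≤sum : ∀ {m} (f : Fin m → ℕ) v → f v ≤ sum f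
term≤sum f zero    = m≤m+n _ _
term≤sum f (suc v) = ≤-trans (term≤sum (f ∘ suc) v) (m≤n+m _ _)

list-sum-tabulate : ∀ {m} (f : Fin m → ℕ) → List.sum (tabulate f) ≡ sum f
list-sum-tabulate {zero}  f = refl
list-sum-tabulate {suc m} f = cong (f zero +_) (list-sum-tabulate (f ∘ suc))

size≡sum : ∀ G (p : Dist G) → size G p ≡ sum p
size≡sum G p = trans (cong List.sum (map-tabulate (λ y → y) p)) (list-sum-tabulate p)

pt-self : ∀ {m} (v : Fin m) c → pt v c v ≡ c
pt-self zero    c = refl
pt-self (suc v) c = pt-self v c

pt-other : ∀ {m} {v y : Fin m} c → y ≢ v → pt v c y ≡ 0
pt-other {v = v} {y} c y≢v with y ≟ v
... | yes y≡v = ⊥-elim (y≢v y≡v)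
... | no  _   = refl

pt-zero : ∀ {m} (v y : Fin m) → pt v 0 y ≡ 0
pt-zero v y with y ≟ v
... | yes _ = refl
... | no  _ = refl

pt-+ : ∀ {m} (v y : Fin m) a b → pt v a y + pt v b y ≡ pt v (a + b) y
pt-+ v y a b with y ≟ v
... | yes _ = refl
... | no  _ = refl

pt-≤ : ∀ {m} (q : Fin m → ℕ) {v c} y → c ≤ q v → pt v c y ≤ q y
pt-≤ q {v} y c≤qv with y ≟ v
... | yes refl = c≤qv
... | no  _    = z≤n

sum-pt : ∀ {m} (v : Fin m) c (h : Fin m → ℕ) → sum (λ y → pt v c y * h y) ≡ c * h v
sum-pt {suc m} zero    c h = trans (cong (c * h zero +_) (sum-replicate-zero m)) (+-identityʳ _)
sum-pt {suc m} (suc v) c h = sum-pt v c (h ∘ suc)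

weight : ∀ {m} → (Fin m → ℕ) → (Fin m → ℕ) → ℕ
weight ω q = sum (λ y → q y * ω y)

weight-cong : ∀ {m} (ω : Fin m → ℕ) {f g : Fin m → ℕ} →
              (∀ y → f y ≡ g y) → weight ω f ≡ weight ω g
weight-cong ω f≗g = sum-cong-≗ (λ y → cong (_* ω y) (f≗g y))

weight-+ : ∀ {m} (ω f g : Fin m → ℕ) → weight ω (λ y → f y + g y) ≡ weight ω f + weight ω g
weight-+ ω f g =
  trans (sum-cong-≗ (λ y → *-distribʳ-+ (ω y) (f y) (g y)))
        (∑-distrib-+ (λ y → f y * ω y) (λ y → g y * ω y))

weight-+ω : ∀ {m} (ω ω′ q : Fin m → ℕ) →
            weight (λ y → ω y + ω′ y) q ≡ weight ω q + weight ω′ q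
weight-+ω ω ω′ q =
  trans (sum-cong-≗ (λ y → *-distribˡ-+ (q y) (ω y) (ω′ y)))
        (∑-distrib-+ (λ y → q y * ω y) (λ y → q y * ω′ y))

weight-pt : ∀ {m} (ω : Fin m → ℕ) v c → weight ω (pt v c) ≡ c * ω v
weight-pt ω v c = sum-pt v c ω

weight-indicator : ∀ {m} (q : Fin m → ℕ) v → weight (pt v 1) q ≡ q v
weight-indicator q v = trans (sum-cong-≗ (λ y → *-comm (q y) (pt v 1 y))) (trans (sum-pt v 1 q) (+-identityʳ _))

weight-const : ∀ {m} c (q : Fin m → ℕ) → weight (λ _ → c) q ≡ sum q * c
weight-const c q = sym (*-distribʳ-sum c q)

*≤weight : ∀ {m} (ω q : Fin m → ℕ) {v c} → c ≤ q v → c * ω v ≤ weight ω q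
*≤weight ω q {v} c≤qv = ≤-trans (*-monoˡ-≤ (ω v) c≤qv) (term≤sum (λ y → q y * ω y) v)

weight-balance : ∀ {m} (ω q′ a q b : Fin m → ℕ) → (∀ y → q′ y + a y ≡ q y + b y) →
                 weight ω q′ + weight ω a ≡ weight ω q + weight ω b
weight-balance ω q′ a q b bal =
  trans (sym (weight-+ ω q′ a)) (trans (weight-cong ω bal) (weight-+ ω q b))

pebble : ∀ {m} → (Fin m → ℕ) → Fin m → Fin m → Fin m → ℕ
pebble p v u y = (p y ∸ pt v 2 y) + pt u 1 y

rubble : ∀ {m} → (Fin m → ℕ) → Fin m → Fin m → Fin m → Fin m → ℕ
rubble p v w u y = ((p y ∸ pt v 1 y) ∸ pt w 1 y) + pt u 1 y

∸-+-cancel : ∀ {a b} c → b ≤ a → (a ∸ b) + c + b ≡ a + c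
∸-+-cancel {a} {b} c b≤a =
  trans (cong (_+ b) (sym (+-∸-comm c b≤a))) (m∸n+n≡m (≤-trans b≤a (m≤m+n a c)))

pt-pair-≤ : ∀ {m} (q : Fin m → ℕ) {v w} y → v ≢ w → 1 ≤ q v → 1 ≤ q w →
            pt v 1 y + pt w 1 y ≤ q y
pt-pair-≤ q {v} {w} y v≢w 1≤qv 1≤qw with y ≟ v | y ≟ w
... | yes refl | yes refl = ⊥-elim (v≢w refl)
... | yes refl | no _     = 1≤qv
... | no _     | yes refl = 1≤qw
... | no _     | no _     = z≤n

pebble-balance : ∀ {m} (p : Fin m → ℕ) {v} u → 2 ≤ p v →
                 ∀ y → pebble p v u y + pt v 2 y ≡ p y + pt u 1 y
pebble-balance p u 2≤pv y = ∸-+-cancel (pt u 1 y) (pt-≤ p y 2≤pv)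

rubble-balance : ∀ {m} (p : Fin m → ℕ) {v w} u → v ≢ w → 1 ≤ p v → 1 ≤ p w →
                 ∀ y → rubble p v w u y + (pt v 1 y + pt w 1 y) ≡ p y + pt u 1 y
rubble-balance p {v} {w} u v≢w 1≤pv 1≤pw y =
  trans (cong (λ z → z + pt u 1 y + (pt v 1 y + pt w 1 y)) (∸-+-assoc (p y) (pt v 1 y) (pt w 1 y)))
        (∸-+-cancel (pt u 1 y) (pt-pair-≤ p y v≢w 1≤pv 1≤pw))

weight-pebble : ∀ {m} (ω p : Fin m → ℕ) {v} u → 2 ≤ p v →
                weight ω (pebble p v u) + 2 * ω v ≡ weight ω p + ω u
weight-pebble ω p {v} u 2≤pv = begin
  weight ω (pebble p v u) + 2 * ω v
    ≡⟨ cong (weight ω (pebble p v u) +_) (weight-pt ω v 2) ⟨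
  weight ω (pebble p v u) + weight ω (pt v 2)
    ≡⟨ weight-balance ω (pebble p v u) (pt v 2) p (pt u 1) (pebble-balance p u 2≤pv) ⟩
  weight ω p + weight ω (pt u 1)
    ≡⟨ cong (weight ω p +_) (trans (weight-pt ω u 1) (*-identityˡ (ω u))) ⟩
  weight ω p + ω u ∎
  where open ≡-Reasoning

weight-rubble : ∀ {m} (ω p : Fin m → ℕ) {v w} u → v ≢ w → 1 ≤ p v → 1 ≤ p w →
                weight ω (rubble p v w u) + (ω v + ω w) ≡ weight ω p + ω u
weight-rubble ω p {v} {w} u v≢w 1≤pv 1≤pw = begin
  weight ω (rubble p v w u) + (ω v + ω w)
    ≡⟨ cong (weight ω (rubble p v w u) +_) pair ⟨
  weight ω (rubble p v w u) + weight ω (λ y → pt v 1 y + pt w 1 y)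
    ≡⟨ weight-balance ω (rubble p v w u) (λ y → pt v 1 y + pt w 1 y) p (pt u 1)
                      (rubble-balance p u v≢w 1≤pv 1≤pw) ⟩
  weight ω p + weight ω (pt u 1)
    ≡⟨ cong (weight ω p +_) (trans (weight-pt ω u 1) (*-identityˡ (ω u))) ⟩
  weight ω p + ω u ∎
  where
  open ≡-Reasoning
  pair : weight ω (λ y → pt v 1 y + pt w 1 y) ≡ ω v + ω w
  pair = trans (weight-+ ω (pt v 1) (pt w 1))
               (cong₂ _+_ (trans (weight-pt ω v 1) (*-identityˡ (ω v)))
                          (trans (weight-pt ω w 1) (*-identityˡ (ω w))))

reachable-◅◅ : ∀ {G p q x} → Star (Move G) p q → Reachable G q x → Reachable G p x
reachable-◅◅ p⇒q (r , q⇒r , 1≤rx) = r , p⇒q ◅◅ q⇒r , 1≤rx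

Transferred : ∀ {m} → Fin m → Fin m → ℕ → (Fin m → ℕ) → (Fin m → ℕ) → Set
Transferred v u t q q₁ = ∀ y → q₁ y + pt v (2 * t) y ≡ q y + pt u t y

transfer : ∀ {G} {v u : Fin (n G)} → Adj G v u → ∀ t {p : Dist G} → 2 * t ≤ p v →
           ∃ λ q → Star (Move G) p q × Transferred v u t p q
transfer {v = v} {u} v~u zero {p} _ = p , ε , λ y → cong₂ _+_ refl (trans (pt-zero v y) (sym (pt-zero u y)))
transfer {G} {v} {u} v~u (suc t) {p} 2+2t≤pv =
  let q , p₁⇒q , bal = transfer v~u t {pebble p v u} 2t≤p₁v
  in q , Move.pebbling v u v~u 2≤pv ◅ p₁⇒q , λ y → begin-equality
    q y + pt v (2 * suc t) y             ≡⟨ cong (λ c → q y + pt v c y) 2*suc-t≡2t+2 ⟩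
    q y + pt v (2 * t + 2) y             ≡⟨ cong (q y +_) (pt-+ v y (2 * t) 2) ⟨
    q y + (pt v (2 * t) y + pt v 2 y)    ≡⟨ +-assoc (q y) _ _ ⟨
    q y + pt v (2 * t) y + pt v 2 y      ≡⟨ cong (_+ pt v 2 y) (bal y) ⟩
    pebble p v u y + pt u t y + pt v 2 y ≡⟨ xy∙z≈xz∙y (pebble p v u y) _ _ ⟩
    pebble p v u y + pt v 2 y + pt u t y ≡⟨ cong (_+ pt u t y) (pebble-balance p u 2≤pv y) ⟩
    p y + pt u 1 y + pt u t y            ≡⟨ +-assoc (p y) _ _ ⟩
    p y + (pt u 1 y + pt u t y)          ≡⟨ cong (p y +_) (pt-+ u y 1 t) ⟩
    p y + pt u (suc t) y                 ∎
  where
  open ≤-Reasoning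
  2+2t≡2*suc-t : 2 + 2 * t ≡ 2 * suc t
  2+2t≡2*suc-t = sym (*-suc 2 t)
  2*suc-t≡2t+2 : 2 * suc t ≡ 2 * t + 2
  2*suc-t≡2t+2 = trans (*-suc 2 t) (+-comm 2 (2 * t))
  2≤pv : 2 ≤ p v
  2≤pv = ≤-trans (≤-trans (m≤m+n 2 (2 * t)) (≤-reflexive 2+2t≡2*suc-t)) 2+2t≤pv
  2t≤p₁v : 2 * t ≤ pebble p v u v
  2t≤p₁v = begin
    2 * t               ≡⟨ m+n∸m≡n 2 (2 * t) ⟨
    2 + 2 * t ∸ 2       ≤⟨ ∸-monoˡ-≤ 2 (≤-trans (≤-reflexive 2+2t≡2*suc-t) 2+2t≤pv) ⟩
    p v ∸ 2             ≡⟨ cong (p v ∸_) (pt-self v 2) ⟨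
    p v ∸ pt v 2 v      ≤⟨ m≤m+n _ _ ⟩
    pebble p v u v      ∎

weight-transfer : ∀ {m} (ω q q₁ : Fin m → ℕ) {v u t} → Transferred v u t q q₁ →
                  weight ω q₁ + 2 * t * ω v ≡ weight ω q + t * ω u
weight-transfer ω q q₁ {v} {u} {t} bal = begin
  weight ω q₁ + 2 * t * ω v              ≡⟨ cong (weight ω q₁ +_) (weight-pt ω v (2 * t)) ⟨
  weight ω q₁ + weight ω (pt v (2 * t))  ≡⟨ weight-balance ω q₁ (pt v (2 * t)) q (pt u t) bal ⟩
  weight ω q + weight ω (pt u t)         ≡⟨ cong (weight ω q +_) (weight-pt ω u t) ⟩
  weight ω q + t * ω u                   ∎
  where open ≡-Reasoning

weight-transfer-source : ∀ {m} (ω q q₁ : Fin m → ℕ) {v u t} → ω v ≡ 1 → ω u ≡ 0 →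
                         Transferred v u t q q₁ → weight ω q₁ + 2 * t ≡ weight ω q
weight-transfer-source ω q q₁ {v} {u} {t} ωv≡1 ωu≡0 bal = begin
  weight ω q₁ + 2 * t
    ≡⟨ cong (weight ω q₁ +_) (trans (cong (2 * t *_) ωv≡1) (*-identityʳ (2 * t))) ⟨
  weight ω q₁ + 2 * t * ω v       ≡⟨ weight-transfer ω q q₁ bal ⟩
  weight ω q + t * ω u            ≡⟨ cong (weight ω q +_) (trans (cong (t *_) ωu≡0) (*-zeroʳ t)) ⟩
  weight ω q + 0                  ≡⟨ +-identityʳ _ ⟩
  weight ω q                      ∎
  where open ≡-Reasoning

weight-transfer-target : ∀ {m} (ω q q₁ : Fin m → ℕ) {v u t} → ω v ≡ 0 → ω u ≡ 1 →
                         Transferred v u t q q₁ → weight ω q₁ ≡ weight ω q + t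
weight-transfer-target ω q q₁ {v} {u} {t} ωv≡0 ωu≡1 bal = begin
  weight ω q₁                     ≡⟨ +-identityʳ _ ⟨
  weight ω q₁ + 0
    ≡⟨ cong (weight ω q₁ +_) (trans (cong (2 * t *_) ωv≡0) (*-zeroʳ (2 * t))) ⟨
  weight ω q₁ + 2 * t * ω v       ≡⟨ weight-transfer ω q q₁ bal ⟩
  weight ω q + t * ω u            ≡⟨ cong (weight ω q +_) (trans (cong (t *_) ωu≡1) (*-identityʳ t)) ⟩
  weight ω q + t                  ∎
  where open ≡-Reasoning

record SelfEmbedding (G : Graph) : Set where
  field
    apply         : Fin (n G) → Fin (n G)
    injective     : ∀ {a b} → apply a ≡ apply b → a ≡ b
    preserves-Adj : ∀ {u v} → Adj G u v → Adj G (apply u) (apply v)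

module _ {G : Graph} (σ : SelfEmbedding G) where
  open SelfEmbedding σ

  pt-apply : ∀ v c y → pt (apply v) c (apply y) ≡ pt v c y
  pt-apply v c y with y ≟ v | apply y ≟ apply v
  ... | yes _   | yes _   = refl
  ... | yes y≡v | no  σ≢  = ⊥-elim (σ≢ (cong apply y≡v))
  ... | no  y≢v | yes σ≡  = ⊥-elim (y≢v (injective σ≡))
  ... | no  _   | no  _   = refl

  move-apply : ∀ {p p′ q : Dist G} → (∀ y → p y ≡ p′ (apply y)) → Move G p q →
               ∃ λ q′ → Move G p′ q′ × (∀ y → q y ≡ q′ (apply y))
  move-apply {p′ = p′} p≗p′σ (Move.pebbling v u v~u 2≤pv) =
    pebble p′ (apply v) (apply u) ,
    Move.pebbling (apply v) (apply u) (preserves-Adj v~u) (subst (2 ≤_) (p≗p′σ v) 2≤pv) ,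
    λ y → cong₂ _+_ (cong₂ _∸_ (p≗p′σ y) (sym (pt-apply v 2 y))) (sym (pt-apply u 1 y))
  move-apply {p′ = p′} p≗p′σ (Move.strict v w u v≢w v~u w~u 1≤pv 1≤pw) =
    rubble p′ (apply v) (apply w) (apply u) ,
    Move.strict (apply v) (apply w) (apply u) (v≢w ∘ injective) (preserves-Adj v~u) (preserves-Adj w~u)
                (subst (1 ≤_) (p≗p′σ v) 1≤pv) (subst (1 ≤_) (p≗p′σ w) 1≤pw) ,
    λ y → cong₂ _+_ (cong₂ _∸_ (cong₂ _∸_ (p≗p′σ y) (sym (pt-apply v 1 y))) (sym (pt-apply w 1 y)))
                    (sym (pt-apply u 1 y))

  reachable-apply : ∀ {p p′ : Dist G} {x} → (∀ y → p y ≡ p′ (apply y)) →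
                    Reachable G p x → Reachable G p′ (apply x)
  reachable-apply {x = x} p≗p′σ (q , ε , 1≤qx) = _ , ε , subst (1 ≤_) (p≗p′σ x) 1≤qx
  reachable-apply p≗p′σ (q , m ◅ ms , 1≤qx) =
    let r′ , m′ , r≗r′σ = move-apply p≗p′σ m
    in reachable-◅◅ (m′ ◅ ε) (reachable-apply r≗r′σ (q , ms , 1≤qx))

div-bounds : ∀ n d′ → suc d′ * (n / suc d′) ≤ n × n ≤ suc d′ * (n / suc d′) + d′
div-bounds n d′ =
  ≤-trans (≤-reflexive (*-comm (suc d′) (n / suc d′))) (m/n*n≤m n (suc d′)) ,
  ≤-trans (≤-reflexive (m≡m%n+[m/n]*n n (suc d′)))
          (≤-trans (+-monoˡ-≤ ((n / suc d′) * suc d′) (s≤s⁻¹ (m%n<n n (suc d′))))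
                   (≤-reflexive (trans (+-comm d′ _) (cong (_+ d′) (*-comm (n / suc d′) (suc d′))))))

2*-cancel-≤-+1 : ∀ {a b} → 2 * a ≤ 2 * b + 1 → a ≤ b
2*-cancel-≤-+1 {a} {b} 2a≤2b+1 =
  s≤s⁻¹ (*-cancelˡ-< 2 a (suc b) (≤-trans (s≤s 2a≤2b+1) (≤-reflexive 2b+2≡2*suc-b)))
  where
  2b+2≡2*suc-b : suc (2 * b + 1) ≡ 2 * suc b
  2b+2≡2*suc-b = trans (+-comm (suc (2 * b)) 1) (sym (*-suc 2 b))

-- Path weights

δ : ℕ → ℕ → ℕ
δ zero    zero    = 1
δ zero    (suc b) = 0
δ (suc a) zero    = 0
δ (suc a) (suc b) = δ a b

δ-refl : ∀ a → δ a a ≡ 1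
δ-refl zero    = refl
δ-refl (suc a) = δ-refl a

δ-≢ : ∀ {a b} → a ≢ b → δ a b ≡ 0
δ-≢ {zero}  {zero}  a≢b = ⊥-elim (a≢b refl)
δ-≢ {zero}  {suc b} _   = refl
δ-≢ {suc a} {zero}  _   = refl
δ-≢ {suc a} {suc b} a≢b = δ-≢ (a≢b ∘ cong suc)

-- pathWeight L j = 2 ^ (L ∸ j) for 1 ≤ j ≤ L, and 0 otherwise.
pathWeight : ℕ → ℕ → ℕ
pathWeight zero    j = 0
pathWeight (suc L) j = 2 * pathWeight L j + δ j (suc L)

pathWeight-beyond : ∀ {L j} → L < j → pathWeight L j ≡ 0
pathWeight-beyond {zero}  _   = refl
pathWeight-beyond {suc L} L<j
  rewrite pathWeight-beyond (<-trans (n<1+n L) L<j) | δ-≢ (≢-sym (<⇒≢ L<j)) = refl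

pathWeight-zero : ∀ L → pathWeight L 0 ≡ 0
pathWeight-zero zero    = refl
pathWeight-zero (suc L) rewrite pathWeight-zero L = refl

pathWeight-last : ∀ L → pathWeight (suc L) (suc L) ≡ 1
pathWeight-last L rewrite pathWeight-beyond (n<1+n L) | δ-refl L = refl

pathWeight-one : ∀ L → pathWeight (suc L) 1 ≡ 2 ^ L
pathWeight-one zero    = refl
pathWeight-one (suc L) rewrite pathWeight-one L = +-identityʳ _

pathWeight-halving : ∀ {L j} → 1 ≤ j → j < L → pathWeight L j ≡ 2 * pathWeight L (suc j)
pathWeight-halving {suc L} {j} 1≤j j<1+L with m≤n⇒m<n∨m≡n (s≤s⁻¹ j<1+L)
... | inj₁ j<L
  rewrite pathWeight-halving 1≤j j<L | δ-≢ (<⇒≢ (m<n⇒m<1+n j<L)) | δ-≢ (<⇒≢ (s≤s j<L)) =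
  trans (+-identityʳ (2 * (2 * pathWeight L (suc j)))) (cong (2 *_) (sym (+-identityʳ (2 * pathWeight L (suc j)))))
... | inj₂ refl with j | 1≤j
...   | suc j′ | _ rewrite pathWeight-last j′ | pathWeight-beyond (n<1+n (suc j′)) | δ-refl j′
                         | δ-≢ (<⇒≢ (n<1+n j′)) = refl

pathWeight-antitone : ∀ {L j} → 1 ≤ j → pathWeight L (suc j) ≤ pathWeight L j
pathWeight-antitone {L} {j} 1≤j with suc j ≤? L
... | yes j<L rewrite pathWeight-halving 1≤j j<L = m≤m+n _ _
... | no  j≮L rewrite pathWeight-beyond (≰⇒> j≮L) = z≤n

1≤pathWeight : ∀ {L j} → 1 ≤ j → j ≤ L → 1 ≤ pathWeight L j
1≤pathWeight {zero}  (s≤s z≤n) ()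
1≤pathWeight {suc L} {j} 1≤j j≤1+L with m≤n⇒m<n∨m≡n j≤1+L
... | inj₁ j<1+L = ≤-trans (1≤pathWeight 1≤j (s≤s⁻¹ j<1+L)) (≤-trans (m≤m+n _ _) (m≤m+n _ _))
... | inj₂ refl  = ≤-reflexive (sym (pathWeight-last L))

2≤pathWeight : ∀ {L j} → 1 ≤ j → j < L → 2 ≤ pathWeight L j
2≤pathWeight {L} {j} 1≤j j<L rewrite pathWeight-halving 1≤j j<L =
  *-monoʳ-≤ 2 (1≤pathWeight {L} {suc j} (s≤s z≤n) j<L)

pathWeight-adjacent : ∀ {L i j} → 1 ≤ i → suc i ≡ j ⊎ suc j ≡ i →
                      pathWeight L j ≤ 2 * pathWeight L i ⊎ (i ≡ suc L × j ≡ L)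
pathWeight-adjacent {L} 1≤i (inj₁ refl) = inj₁ (≤-trans (pathWeight-antitone {L} 1≤i) (m≤m+n _ _))
pathWeight-adjacent {L} {i} {zero} 1≤i (inj₂ refl) rewrite pathWeight-zero L = inj₁ z≤n
pathWeight-adjacent {L} {i} {suc j} 1≤i (inj₂ refl) with <-cmp (suc j) L
... | tri< j<L _ _ = inj₁ (≤-reflexive (pathWeight-halving (s≤s z≤n) j<L))
... | tri≈ _ refl _ = inj₂ (refl , refl)
... | tri> _ _ j>L rewrite pathWeight-beyond j>L = inj₁ z≤n

-- The path vertex 1, …, vertex L of G; index locates a vertex on it, any value outside
-- 1 … L meaning that the vertex is off the path.
record Path (G : Graph) (L : ℕ) : Set where
  field
    index        : Fin (n G) → ℕ
    vertex       : ℕ → Fin (n G)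
    index-vertex : ∀ {j} → 1 ≤ j → j ≤ L → index (vertex j) ≡ j
    vertex-index : ∀ {y} → 1 ≤ index y → index y ≤ L → vertex (index y) ≡ y
    adjacent     : ∀ {j} → 1 ≤ j → j < L → Adj G (vertex (suc j)) (vertex j)

module _ {G : Graph} {L : ℕ} (P : Path G L) where
  open Path P

  OffPrefix : ℕ → Fin (n G) → Set
  OffPrefix l y = index y ≡ 0 ⊎ l < index y

  OffPrefix⇒≢vertex : ∀ {l j y} → OffPrefix l y → 1 ≤ j → j ≤ l → j ≤ L → y ≢ vertex j
  OffPrefix⇒≢vertex (inj₁ iy≡0) 1≤j _ j≤L refl =
    1+n≰n (≤-trans 1≤j (≤-reflexive (trans (sym (index-vertex 1≤j j≤L)) iy≡0)))
  OffPrefix⇒≢vertex (inj₂ l<iy) 1≤j j≤l j≤L refl =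
    1+n≰n (≤-trans l<iy (≤-trans (≤-reflexive (index-vertex 1≤j j≤L)) j≤l))

  δ-index : ∀ {j} → 1 ≤ j → j ≤ L → ∀ y → δ (index y) j ≡ pt (vertex j) 1 y
  δ-index {j} 1≤j j≤L y with y ≟ vertex j
  ... | yes refl = trans (cong (λ i → δ i j) (index-vertex 1≤j j≤L)) (δ-refl j)
  ... | no  y≢vj = δ-≢ λ iy≡j → y≢vj (trans (sym (vertex-index (subst (1 ≤_) (sym iy≡j) 1≤j)
                                                                 (subst (_≤ L) (sym iy≡j) j≤L)))
                                            (cong vertex iy≡j))

  prefixWeight : ℕ → Fin (n G) → ℕ
  prefixWeight l y = pathWeight l (index y)

  weight-prefixWeight-suc : ∀ {l} → suc l ≤ L → (q : Dist G) →
                            weight (prefixWeight (suc l)) q ≡ 2 * weight (prefixWeight l) q + q (vertex (suc l))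
  weight-prefixWeight-suc {l} l<L q = begin
    weight (prefixWeight (suc l)) q
      ≡⟨ weight-+ω (λ y → 2 * prefixWeight l y) (λ y → δ (index y) (suc l)) q ⟩
    weight (λ y → 2 * prefixWeight l y) q + weight (λ y → δ (index y) (suc l)) q
      ≡⟨ cong₂ _+_ (trans (sum-cong-≗ λ y → *-Semigroup.x∙yz≈y∙xz (q y) 2 (prefixWeight l y))
                          (sym (*-distribˡ-sum 2 (λ y → q y * prefixWeight l y))))
                   (trans (sum-cong-≗ λ y → cong (q y *_) (δ-index (s≤s z≤n) l<L y))
                          (weight-indicator q (vertex (suc l)))) ⟩
    2 * weight (prefixWeight l) q + q (vertex (suc l)) ∎
    where open ≡-Reasoning

  -- Pebbling half of the pile on vertex l + 2 onto vertex l + 1 keeps half the weight up to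
  -- rounding; then recurse on the shorter prefix.
  collect : ∀ l → suc l ≤ L → ∀ m {q : Dist G} → m * 2 ^ l ≤ weight (prefixWeight (suc l)) q →
            ∃ λ q′ → Star (Move G) q q′ × m ≤ q′ (vertex 1) ×
                     (∀ y → OffPrefix (suc l) y → q′ y ≡ q y)
  collect zero 1≤L m {q} m≤W =
    q , ε , ≤-trans (≤-reflexive (sym (*-identityʳ m)))
                    (≤-trans m≤W (≤-reflexive (trans (sum-cong-≗ λ y → cong (q y *_) (δ-index ≤-refl 1≤L y))
                                                     (weight-indicator q (vertex 1))))) ,
    λ _ _ → refl
  collect (suc l) l+2≤L m {q} m2ˡ⁺¹≤W =
    let q₁ , q⇒q₁ , bal = transfer (adjacent (s≤s z≤n) l+2≤L) t {q} 2t≤c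
        q′ , q₁⇒q′ , m≤q′v₁ , q′≗q₁ = collect l l+1≤L m {q₁} (m2ˡ≤W₁ q₁ bal)
    in q′ , q⇒q₁ ◅◅ q₁⇒q′ , m≤q′v₁ ,
       λ y off → trans (q′≗q₁ y (weaken off)) (unmoved q₁ bal y off)
    where
    open ≤-Reasoning
    l+1≤L : suc l ≤ L
    l+1≤L = ≤-trans (n≤1+n _) l+2≤L
    v u : Fin (n G)
    v = vertex (suc (suc l))
    u = vertex (suc l)
    c t : ℕ
    c = q v
    t = c / 2
    2t≤c : 2 * t ≤ c
    2t≤c = proj₁ (div-bounds c 1)
    W : Dist G → ℕ
    W = weight (prefixWeight (suc l))
    W-after : ∀ q₁ → Transferred v u t q q₁ → W q₁ ≡ W q + t
    W-after q₁ = weight-transfer-target (prefixWeight (suc l)) q q₁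
      (trans (cong (pathWeight (suc l)) (index-vertex (s≤s z≤n) l+2≤L)) (pathWeight-beyond (n<1+n (suc l))))
      (trans (cong (pathWeight (suc l)) (index-vertex (s≤s z≤n) l+1≤L)) (pathWeight-last l))
    m2ˡ≤W₁ : ∀ q₁ → Transferred v u t q q₁ → m * 2 ^ l ≤ W q₁
    m2ˡ≤W₁ q₁ bal = 2*-cancel-≤-+1 (begin
      2 * (m * 2 ^ l)           ≡⟨ *-Semigroup.x∙yz≈y∙xz 2 m (2 ^ l) ⟩
      m * 2 ^ suc l             ≤⟨ m2ˡ⁺¹≤W ⟩
      weight (prefixWeight (suc (suc l))) q ≡⟨ weight-prefixWeight-suc l+2≤L q ⟩
      2 * W q + c               ≤⟨ +-monoʳ-≤ (2 * W q) (proj₂ (div-bounds c 1)) ⟩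
      2 * W q + (2 * t + 1)     ≡⟨ +-assoc (2 * W q) (2 * t) 1 ⟨
      2 * W q + 2 * t + 1       ≡⟨ cong (_+ 1) (*-distribˡ-+ 2 (W q) t) ⟨
      2 * (W q + t) + 1         ≡⟨ cong (λ z → 2 * z + 1) (W-after q₁ bal) ⟨
      2 * W q₁ + 1              ∎)
    weaken : ∀ {y} → OffPrefix (suc (suc l)) y → OffPrefix (suc l) y
    weaken (inj₁ iy≡0)  = inj₁ iy≡0
    weaken (inj₂ l+2<iy) = inj₂ (<-trans (n<1+n _) l+2<iy)
    unmoved : ∀ q₁ → Transferred v u t q q₁ → ∀ y → OffPrefix (suc (suc l)) y → q₁ y ≡ q y
    unmoved q₁ bal y off = +-cancelʳ-≡ 0 (q₁ y) (q y) (begin-equality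
      q₁ y + 0              ≡⟨ cong (q₁ y +_) (pt-other (2 * t) y≢v) ⟨
      q₁ y + pt v (2 * t) y ≡⟨ bal y ⟩
      q y + pt u t y        ≡⟨ cong (q y +_) (pt-other t y≢u) ⟩
      q y + 0               ∎)
      where
      y≢v : y ≢ v
      y≢v = OffPrefix⇒≢vertex off (s≤s z≤n) ≤-refl l+2≤L
      y≢u : y ≢ u
      y≢u = OffPrefix⇒≢vertex off (s≤s z≤n) (n≤1+n _) l+1≤L

-- Rotating the cycle

rotate : ∀ {N} → Fin (suc N) → Fin (suc N)
rotate {N} zero = fromℕ N
rotate (suc i)  = inject₁ i

rotate-injective : ∀ {N} {a b : Fin (suc N)} → rotate a ≡ rotate b → a ≡ b
rotate-injective {a = zero}  {zero}  _ = refl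
rotate-injective {N} {zero}  {suc b} e =
  ⊥-elim (<⇒≢ (toℕ<n b) (trans (sym (toℕ-inject₁ b)) (trans (cong toℕ (sym e)) (toℕ-fromℕ N))))
rotate-injective {N} {suc a} {zero}  e =
  ⊥-elim (<⇒≢ (toℕ<n a) (trans (sym (toℕ-inject₁ a)) (trans (cong toℕ e) (toℕ-fromℕ N))))
rotate-injective {a = suc a} {suc b} e =
  cong suc (toℕ-injective (trans (sym (toℕ-inject₁ a)) (trans (cong toℕ e) (toℕ-inject₁ b))))

rotate-Adj : ∀ {N} → 1 ≤ N → ∀ {u v} → Adj (Cycle (suc N)) u v → Adj (Cycle (suc N)) (rotate u) (rotate v)
rotate-Adj {N} _ {zero} {suc v} (inj₁ e) =
  inj₂ (inj₂ (inj₂ (trans (toℕ-inject₁ v) (suc-injective (sym e)) , cong suc (toℕ-fromℕ N))))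
rotate-Adj _ {suc u} {suc v} (inj₁ e) =
  inj₁ (trans (cong suc (toℕ-inject₁ u)) (trans (suc-injective e) (sym (toℕ-inject₁ v))))
rotate-Adj {N} _ {suc u} {zero} (inj₂ (inj₁ e)) =
  inj₂ (inj₂ (inj₁ (trans (toℕ-inject₁ u) (suc-injective (sym e)) , cong suc (toℕ-fromℕ N))))
rotate-Adj _ {suc u} {suc v} (inj₂ (inj₁ e)) =
  inj₂ (inj₁ (trans (cong suc (toℕ-inject₁ v)) (trans (suc-injective e) (sym (toℕ-inject₁ u)))))
rotate-Adj 1≤N {zero} {zero} (inj₂ (inj₂ (inj₁ (_ , e)))) = ⊥-elim (<⇒≢ 1≤N (suc-injective e))
rotate-Adj {N} _ {zero} {suc v} (inj₂ (inj₂ (inj₁ (_ , e)))) =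
  inj₂ (inj₁ (trans (cong suc (toℕ-inject₁ v)) (trans (suc-injective e) (sym (toℕ-fromℕ N)))))
rotate-Adj 1≤N {zero} {zero} (inj₂ (inj₂ (inj₂ (_ , e)))) = ⊥-elim (<⇒≢ 1≤N (suc-injective e))
rotate-Adj {N} _ {suc u} {zero} (inj₂ (inj₂ (inj₂ (_ , e)))) =
  inj₁ (trans (cong suc (toℕ-inject₁ u)) (trans (suc-injective e) (sym (toℕ-fromℕ N))))
rotate-Adj _ {suc u} {_}     (inj₂ (inj₂ (inj₁ (() , _))))
rotate-Adj _ {_}     {suc v} (inj₂ (inj₂ (inj₂ (() , _))))

rotation : ∀ {N} → 1 ≤ N → SelfEmbedding (Cycle (suc N))
rotation 1≤N = record { apply = rotate ; injective = rotate-injective ; preserves-Adj = rotate-Adj 1≤N }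

size-rotate : ∀ {N} (p : Fin (suc N) → ℕ) → size (Cycle (suc N)) (p ∘ rotate) ≡ size (Cycle (suc N)) p
size-rotate {N} p = begin
  size (Cycle (suc N)) (p ∘ rotate)        ≡⟨ size≡sum (Cycle (suc N)) (p ∘ rotate) ⟩
  p (fromℕ N) + sum (p ∘ inject₁)          ≡⟨ +-comm (p (fromℕ N)) _ ⟩
  sum (p ∘ inject₁) + p (fromℕ N)          ≡⟨ sum-init-last p ⟨
  sum p                                    ≡⟨ size≡sum (Cycle (suc N)) p ⟨
  size (Cycle (suc N)) p                   ∎
  where open ≡-Reasoning

rotate-induction : ∀ {N} (P : Fin (suc N) → Set) → P zero → (∀ y → P y → P (rotate y)) → ∀ x → P x
rotate-induction {N} P P0 P-rotate x = go (N ∸ toℕ x) x (m+[n∸m]≡n (toℕ≤pred[n] x))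
  where
  go : ∀ d x → toℕ x + d ≡ N → P x
  go zero x x+0≡N = subst P (toℕ-injective (trans (toℕ-fromℕ N) (sym (trans (sym (+-identityʳ _)) x+0≡N))))
                          (P-rotate zero P0)
  go (suc d) x x+1+d≡N = subst P (inject₁-lower₁ x x≢N) (P-rotate (suc (lower₁ x x≢N)) (go d _ (begin
      suc (toℕ (lower₁ x x≢N)) + d ≡⟨ cong (λ i → suc i + d) (toℕ-lower₁ x x≢N) ⟩
      suc (toℕ x) + d              ≡⟨ +-suc (toℕ x) d ⟨
      toℕ x + suc d                ≡⟨ x+1+d≡N ⟩
      N                            ∎)))
    where
    open ≡-Reasoning
    x≢N : N ≢ toℕ x
    x≢N N≡x = m+1+n≢m (toℕ x) (trans x+1+d≡N N≡x)

infixr 5 _⊕_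
infix  6 _⊗_

_⊕_ : ∀ {a b c d} → a ≤ b → c ≤ d → a + c ≤ b + d
_⊕_ = +-mono-≤

_⊗_ : ∀ c {a b} → a ≤ b → c * a ≤ c * b
c ⊗ a≤b = *-monoʳ-≤ c a≤b

-- Infeasibility certificate: l ≤ r is a nonnegative combination of the hypotheses,
-- while l = r + 1 + j holds identically.
refute : ∀ {l r} → l ≤ r → ∀ j → l ≡ r + suc j → ⊥
refute l≤r j l≡r+1+j = m+1+n≰m _ (subst (_≤ _) l≡r+1+j l≤r)

-- Balancing the two branches

data FinalMove : ℕ → ℕ → Set where
  pebbleFromA : FinalMove 2 0
  pebbleFromB : FinalMove 0 2
  rubbleFromBoth : FinalMove 1 1

FinalMove-swap : ∀ {ma mb} → FinalMove ma mb → FinalMove mb ma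
FinalMove-swap pebbleFromA    = pebbleFromB
FinalMove-swap pebbleFromB    = pebbleFromA
FinalMove-swap rubbleFromBoth = rubbleFromBoth

-- X and Y are the weights of the two branches and ea, eb the pebbles on their far ends.
-- Shifting t pebbles across the far edge costs 2t on one side and gains t on the other;
-- afterwards each branch must carry ma (resp. mb) units of H for the final move.
data Plan (H X Y ea eb : ℕ) : Set where
  shiftAB : ∀ t {ma mb} → FinalMove ma mb →
            2 * t ≤ ea → ma * H + 2 * t ≤ X → mb * H ≤ Y + t → Plan H X Y ea eb
  shiftBA : ∀ t {ma mb} → FinalMove ma mb →
            2 * t ≤ eb → ma * H ≤ X + t → mb * H + 2 * t ≤ Y → Plan H X Y ea eb

Plan-swap : ∀ {H X Y ea eb} → Plan H Y X eb ea → Plan H X Y ea eb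
Plan-swap (shiftAB t fm 2t≤eb h₁ h₂) = shiftBA t (FinalMove-swap fm) 2t≤eb h₂ h₁
Plan-swap (shiftBA t fm 2t≤ea h₁ h₂) = shiftAB t (FinalMove-swap fm) 2t≤ea h₂ h₁

module Planning {H m X Y ea eb : ℕ} (7H≤3m+1 : 7 * H ≤ 3 * m + 1) (2m≤S : 2 * m ≤ X + Y + ea + eb)
         (ea≤X : ea ≤ X) (eb≤Y : eb ≤ Y) where

  -- Either shift d pebbles from branch A's far end to raise Y to H, or e pebbles from
  -- branch B's far end to raise X to 2H; when neither is affordable there are too few pebbles.
  plan-balanced : ∀ {d e} → Y + d ≡ H → X + e ≡ 2 * H → Plan H X Y ea eb
  plan-balanced {d} {e} Y+d≡H X+e≡2H with 2 * e ≤? eb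
  ... | yes 2e≤eb = shiftBA e pebbleFromA 2e≤eb (≤-reflexive (sym X+e≡2H)) (≤-trans 2e≤eb eb≤Y)
  ... | no 2e≰eb with 2 * d ≤? ea
  ...   | no 2d≰ea = ⊥-elim $
    refute (6 ⊗ 2m≤S ⊕ 6 ⊗ ≰⇒> 2d≰ea ⊕ 3 ⊗ ≰⇒> 2e≰eb ⊕ 3 ⊗ eb≤Y ⊕
            12 ⊗ ≤-reflexive Y+d≡H ⊕ 6 ⊗ ≤-reflexive X+e≡2H ⊕ 4 ⊗ 7H≤3m+1)
           (4 + 3 * Y + 4 * H) (solve (H ∷ m ∷ X ∷ Y ∷ ea ∷ eb ∷ d ∷ e ∷ []))
  ...   | yes 2d≤ea with H + 2 * d ≤? X
  ...     | yes H+2d≤X =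
    shiftAB d rubbleFromBoth 2d≤ea (subst (λ z → z + 2 * d ≤ X) (sym (*-identityˡ H)) H+2d≤X)
            (≤-reflexive (trans (*-identityˡ H) (sym Y+d≡H)))
  ...     | no H+2d≰X = ⊥-elim $
    refute (3 ⊗ 2m≤S ⊕ 3 ⊗ ea≤X ⊕ 2 ⊗ ≰⇒> 2e≰eb ⊕ 4 ⊗ ≤-reflexive X+e≡2H ⊕ eb≤Y ⊕
            2 ⊗ ≰⇒> H+2d≰X ⊕ 4 ⊗ ≤-reflexive Y+d≡H ⊕ 2 ⊗ 7H≤3m+1)
           1 (solve (H ∷ m ∷ X ∷ Y ∷ ea ∷ eb ∷ d ∷ e ∷ []))

  plan-one-light : Y < H → Plan H X Y ea eb
  plan-one-light Y<H with 2 * H ≤? X | H ≤? X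
  ... | yes 2H≤X | _ = shiftAB 0 pebbleFromA z≤n (≤-trans (≤-reflexive (+-identityʳ (2 * H))) 2H≤X) z≤n
  ... | no 2H≰X | yes _ = plan-balanced (m+[n∸m]≡n (<⇒≤ Y<H)) (m+[n∸m]≡n (<⇒≤ (≰⇒> 2H≰X)))
  ... | no _ | no X≱H = ⊥-elim $
    refute (3 ⊗ 2m≤S ⊕ 3 ⊗ ea≤X ⊕ 3 ⊗ eb≤Y ⊕ 6 ⊗ ≰⇒> X≱H ⊕ 6 ⊗ Y<H ⊕ 2 ⊗ 7H≤3m+1)
           (9 + 2 * H) (solve (H ∷ m ∷ X ∷ Y ∷ ea ∷ eb ∷ []))

plan : ∀ {H m X Y ea eb} → 7 * H ≤ 3 * m + 1 → 2 * m ≤ X + Y + ea + eb → ea ≤ X → eb ≤ Y →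
       Plan H X Y ea eb
plan {H} {m} {X} {Y} {ea} {eb} 7H≤3m+1 2m≤S ea≤X eb≤Y with H ≤? X | H ≤? Y
... | yes H≤X | yes H≤Y =
  shiftAB 0 rubbleFromBoth z≤n (≤-trans (≤-reflexive (trans (+-identityʳ (1 * H)) (*-identityˡ H))) H≤X)
          (≤-trans (≤-reflexive (*-identityˡ H)) (≤-trans H≤Y (≤-reflexive (sym (+-identityʳ Y)))))
... | _       | no Y≱H  = Planning.plan-one-light {m = m} 7H≤3m+1 2m≤S ea≤X eb≤Y (≰⇒> Y≱H)
... | no X≱H  | yes _   =
  Plan-swap (Planning.plan-one-light {m = m} 7H≤3m+1 (≤-trans 2m≤S (≤-reflexive swapped)) eb≤Y ea≤X (≰⇒> X≱H))
  where
  swapped : X + Y + ea + eb ≡ Y + X + eb + ea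
  swapped = solve (X ∷ Y ∷ ea ∷ eb ∷ [])

-- The slack invariant

cross-slack : ∀ {A B X Y X′ Y′ s t} → X′ + 2 ≡ X → Y′ ≡ Y + 1 →
              X + 2 * s ≤ A + t → Y + 2 * t ≤ B + s →
              X′ + 2 * suc s ≤ A + t × Y′ + 2 * t ≤ B + suc s
cross-slack {A} {B} {X} {Y} {X′} {Y′} {s} {t} X′+2≡X Y′≡Y+1 hX hY = hX′ , hY′
  where
  open ≤-Reasoning
  hX′ : X′ + 2 * suc s ≤ A + t
  hX′ = begin
    X′ + 2 * suc s  ≡⟨ solve (X′ ∷ s ∷ []) ⟩
    X′ + 2 + 2 * s  ≡⟨ cong (_+ 2 * s) X′+2≡X ⟩
    X + 2 * s       ≤⟨ hX ⟩
    A + t           ∎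
  hY′ : Y′ + 2 * t ≤ B + suc s
  hY′ = begin
    Y′ + 2 * t      ≡⟨ cong (_+ 2 * t) Y′≡Y+1 ⟩
    Y + 1 + 2 * t   ≡⟨ solve (Y ∷ t ∷ []) ⟩
    Y + 2 * t + 1   ≤⟨ +-monoˡ-≤ 1 hY ⟩
    B + s + 1       ≡⟨ solve (B ∷ s ∷ []) ⟩
    B + suc s       ∎

balance⇒≤ : ∀ {W′ W c d} → W′ + c ≡ W + d → d ≤ c → W′ ≤ W
balance⇒≤ {W′} {W} {c} e d≤c = +-cancelʳ-≤ c W′ W (≤-trans (≤-reflexive e) (+-monoʳ-≤ W d≤c))

balance-at : ∀ {W′ W c c′ d d′} → W′ + 2 * c ≡ W + d → c ≡ c′ → d ≡ d′ → W′ + 2 * c′ ≡ W + d′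
balance-at e refl refl = e

slack-infeasible : ∀ {H A B X Y s t} → 3 * (A + B) + 2 ≤ 7 * H → 2 * H ≤ 3 * B + 3 → 3 * B + 1 ≤ 2 * H →
                   X + 2 * s ≤ A + t → Y + 2 * t ≤ B + s →
                   2 * H ≤ X ⊎ 2 * H ≤ Y ⊎ (H ≤ X × H ≤ Y) → ⊥
slack-infeasible {H} {A} {B} {X} {Y} {s} {t} h₁ h₂ _ hX hY (inj₁ 2H≤X) =
  refute (6 ⊗ hX ⊕ 3 ⊗ hY ⊕ 2 ⊗ h₁ ⊕ h₂ ⊕ 6 ⊗ 2H≤X)
         (9 * s + 3 * Y) (solve (H ∷ A ∷ B ∷ X ∷ Y ∷ s ∷ t ∷ []))
slack-infeasible {H} {A} {B} {X} {Y} {s} {t} h₁ _ h₃ hX hY (inj₂ (inj₁ 2H≤Y)) =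
  refute (6 ⊗ hY ⊕ 3 ⊗ hX ⊕ h₁ ⊕ h₃ ⊕ 6 ⊗ 2H≤Y)
         (9 * t + 3 * X + 3 * H + 2) (solve (H ∷ A ∷ B ∷ X ∷ Y ∷ s ∷ t ∷ []))
slack-infeasible {H} {A} {B} {X} {Y} {s} {t} h₁ _ h₃ hX hY (inj₂ (inj₂ (H≤X , H≤Y))) =
  refute (3 ⊗ hX ⊕ 6 ⊗ hY ⊕ h₁ ⊕ h₃ ⊕ 3 ⊗ H≤X ⊕ 6 ⊗ H≤Y)
         (9 * t + 2) (solve (H ∷ A ∷ B ∷ X ∷ Y ∷ s ∷ t ∷ []))

-- The rubbling number is F + 1; the extremal distribution of size F has A and B pebbles on
-- the two vertices of the far edge.
module Threshold (H : ℕ) (1≤H : 1 ≤ H) where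

  F B A : ℕ
  F = (7 * H ∸ 2) / 3
  B = (2 * H ∸ 1) / 3
  A = F ∸ B

  private
    a+2≡7H : 7 * H ∸ 2 + 2 ≡ 7 * H
    a+2≡7H = m∸n+n≡m (≤-trans (s≤s (s≤s z≤n)) (*-monoʳ-≤ 7 1≤H))

    b+1≡2H : 2 * H ∸ 1 + 1 ≡ 2 * H
    b+1≡2H = m∸n+n≡m (≤-trans 1≤H (m≤m+n H _))

    3F≤a : 3 * F ≤ 7 * H ∸ 2
    3F≤a = proj₁ (div-bounds (7 * H ∸ 2) 2)

    a≤3F+2 : 7 * H ∸ 2 ≤ 3 * F + 2
    a≤3F+2 = proj₂ (div-bounds (7 * H ∸ 2) 2)

    3B≤b : 3 * B ≤ 2 * H ∸ 1
    3B≤b = proj₁ (div-bounds (2 * H ∸ 1) 2)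

    b≤3B+2 : 2 * H ∸ 1 ≤ 3 * B + 2
    b≤3B+2 = proj₂ (div-bounds (2 * H ∸ 1) 2)

    thirds-ordered : ∀ {a b F B} → a + 2 ≡ 7 * H → b + 1 ≡ 2 * H → a ≤ 3 * F + 2 → 3 * B ≤ b → B ≤ F
    thirds-ordered {a} {b} {F} {B} a+2≡7H b+1≡2H a≤3F+2 3B≤b with B ≤? F
    ... | yes B≤F = B≤F
    ... | no  B≰F = ⊥-elim $
      refute (3 ⊗ ≰⇒> B≰F ⊕ 3B≤b ⊕ a≤3F+2 ⊕ ≤-reflexive (sym a+2≡7H) ⊕ ≤-reflexive b+1≡2H ⊕
              5 ⊗ 1≤H)
             4 (solve (H ∷ a ∷ b ∷ F ∷ B ∷ []))

  A+B≡F : A + B ≡ F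
  A+B≡F = m∸n+n≡m (thirds-ordered {F = F} {B = B} a+2≡7H b+1≡2H a≤3F+2 3B≤b)

  7H≤3[F+1]+1 : 7 * H ≤ 3 * (F + 1) + 1
  7H≤3[F+1]+1 = begin
    7 * H             ≡⟨ a+2≡7H ⟨
    7 * H ∸ 2 + 2     ≤⟨ +-monoˡ-≤ 2 a≤3F+2 ⟩
    3 * F + 2 + 2     ≡⟨ regroup F ⟩
    3 * (F + 1) + 1   ∎
    where
    open ≤-Reasoning
    regroup : ∀ x → 3 * x + 2 + 2 ≡ 3 * (x + 1) + 1
    regroup x = solve (x ∷ [])

  3[A+B]+2≤7H : 3 * (A + B) + 2 ≤ 7 * H
  3[A+B]+2≤7H = begin
    3 * (A + B) + 2   ≡⟨ cong (λ z → 3 * z + 2) A+B≡F ⟩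
    3 * F + 2         ≤⟨ +-monoˡ-≤ 2 3F≤a ⟩
    7 * H ∸ 2 + 2     ≡⟨ a+2≡7H ⟩
    7 * H             ∎
    where open ≤-Reasoning

  2H≤3B+3 : 2 * H ≤ 3 * B + 3
  2H≤3B+3 = begin
    2 * H             ≡⟨ b+1≡2H ⟨
    2 * H ∸ 1 + 1     ≤⟨ +-monoˡ-≤ 1 b≤3B+2 ⟩
    3 * B + 2 + 1     ≡⟨ +-assoc (3 * B) 2 1 ⟩
    3 * B + 3         ∎
    where open ≤-Reasoning

  3B+1≤2H : 3 * B + 1 ≤ 2 * H
  3B+1≤2H = ≤-trans (+-monoˡ-≤ 1 3B≤b) (≤-reflexive b+1≡2H)

-- The odd cycle

module OddCycle (k′ : ℕ) where

  k N H : ℕ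
  k = suc k′
  N = k + k
  H = 2 ^ k′

  G : Graph
  G = Cycle (suc N)

  k<N : k < N
  k<N = m<m+n k (s≤s z≤n)

  vertexAt : ℕ → Fin (suc N)
  vertexAt j with j <? suc N
  ... | yes j<1+N = fromℕ< j<1+N
  ... | no  _     = zero

  toℕ-vertexAt : ∀ {j} → j ≤ N → toℕ (vertexAt j) ≡ j
  toℕ-vertexAt {j} j≤N with j <? suc N
  ... | yes j<1+N = toℕ-fromℕ< j<1+N
  ... | no  j≮1+N = ⊥-elim (j≮1+N (s≤s j≤N))

  vertexAt-toℕ : ∀ y → vertexAt (toℕ y) ≡ y
  vertexAt-toℕ y = toℕ-injective (toℕ-vertexAt (toℕ≤pred[n] y))

  -- The index of a vertex counted from the target the other way round the cycle.
  mirror : ℕ → ℕ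
  mirror i = suc N ∸ i

  mirror-involutive : ∀ {i} → i ≤ suc N → mirror (mirror i) ≡ i
  mirror-involutive = m∸[m∸n]≡n

  mirror-suc : ∀ {i} → i ≤ N → mirror i ≡ suc (mirror (suc i))
  mirror-suc = +-∸-assoc 1

  1≤mirror : ∀ {i} → i ≤ N → 1 ≤ mirror i
  1≤mirror i≤N = m<n⇒0<n∸m (s≤s i≤N)

  mirror≤N : ∀ {i} → 1 ≤ i → mirror i ≤ N
  mirror≤N {suc i} _ = m∸n≤m N i

  mirror-k : mirror k ≡ suc k
  mirror-k = trans (mirror-suc (<⇒≤ k<N)) (cong suc (m+n∸m≡n k k))

  toℕ≤N : ∀ (y : Fin (suc N)) → toℕ y ≤ N
  toℕ≤N = toℕ≤pred[n]

  k≤N : k ≤ N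
  k≤N = <⇒≤ k<N

  pathA : Path G k
  pathA = record
    { index        = toℕ
    ; vertex       = vertexAt
    ; index-vertex = λ _ j≤k → toℕ-vertexAt (≤-trans j≤k k≤N)
    ; vertex-index = λ {y} _ _ → vertexAt-toℕ y
    ; adjacent     = λ {j} _ j<k → inj₂ (inj₁ (trans (cong suc (toℕ-vertexAt (≤-trans (<⇒≤ j<k) k≤N)))
                                                     (sym (toℕ-vertexAt (≤-trans j<k k≤N)))))
    }

  pathB : Path G k
  pathB = record
    { index        = λ y → mirror (toℕ y)
    ; vertex       = λ j → vertexAt (mirror j)
    ; index-vertex = λ 1≤j j≤k → trans (cong mirror (toℕ-vertexAt (mirror≤N 1≤j)))
                                        (mirror-involutive (≤-trans j≤k (≤-trans k≤N (n≤1+n N))))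
    ; vertex-index = λ {y} _ _ → trans (cong vertexAt (mirror-involutive (≤-trans (toℕ≤N y) (n≤1+n N))))
                                       (vertexAt-toℕ y)
    ; adjacent     = λ {j} 1≤j j<k → inj₁ (trans (cong suc (toℕ-vertexAt (mirror≤N {suc j} (s≤s z≤n))))
                                           (trans (sym (mirror-suc (≤-trans (<⇒≤ j<k) k≤N)))
                                                  (sym (toℕ-vertexAt (mirror≤N 1≤j)))))
    }

  ωa ωb : Fin (suc N) → ℕ
  ωa = prefixWeight pathA k
  ωb = prefixWeight pathB k

  farA farB : Fin (suc N)
  farA = vertexAt k
  farB = vertexAt (suc k)

  toℕ-farA : toℕ farA ≡ k
  toℕ-farA = toℕ-vertexAt k≤N

  toℕ-farB : toℕ farB ≡ suc k
  toℕ-farB = toℕ-vertexAt k<N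

  mirror-swap : ∀ {i j} → i ≤ suc N → mirror i ≡ j → i ≡ mirror j
  mirror-swap i≤1+N refl = sym (mirror-involutive i≤1+N)

  mirror-1+k : mirror (suc k) ≡ k
  mirror-1+k = sym (mirror-swap (≤-trans k≤N (n≤1+n N)) mirror-k)

  ωa-at-k : ∀ {y} → toℕ y ≡ k → ωa y ≡ 1
  ωa-at-k y≡k = trans (cong (pathWeight k) y≡k) (pathWeight-last k′)

  ωa-at-1+k : ∀ {y} → toℕ y ≡ suc k → ωa y ≡ 0
  ωa-at-1+k y≡1+k = trans (cong (pathWeight k) y≡1+k) (pathWeight-beyond (n<1+n k))

  ωb-at-k : ∀ {y} → toℕ y ≡ k → ωb y ≡ 0
  ωb-at-k y≡k =
    trans (cong (pathWeight k ∘ mirror) y≡k) (trans (cong (pathWeight k) mirror-k) (pathWeight-beyond (n<1+n k)))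

  ωb-at-1+k : ∀ {y} → toℕ y ≡ suc k → ωb y ≡ 1
  ωb-at-1+k y≡1+k =
    trans (cong (pathWeight k ∘ mirror) y≡1+k) (trans (cong (pathWeight k) mirror-1+k) (pathWeight-last k′))

  ωa-at-1 : ∀ {y} → toℕ y ≡ 1 → ωa y ≡ H
  ωa-at-1 y≡1 = trans (cong (pathWeight k) y≡1) (pathWeight-one k′)

  ωb-at-N : ∀ {y} → toℕ y ≡ N → ωb y ≡ H
  ωb-at-N y≡N =
    trans (cong (pathWeight k ∘ mirror) y≡N) (trans (cong (pathWeight k) (m+n∸n≡m 1 N)) (pathWeight-one k′))

  Adj-zero : ∀ {v} → Adj G v zero → toℕ v ≡ 1 ⊎ toℕ v ≡ N
  Adj-zero (inj₂ (inj₁ e))              = inj₁ (sym e)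
  Adj-zero (inj₂ (inj₂ (inj₁ (_ , e)))) = ⊥-elim (<⇒≢ (≤-trans (s≤s z≤n) k<N) (suc-injective e))
  Adj-zero (inj₂ (inj₂ (inj₂ (_ , e)))) = inj₂ (suc-injective e)

  Adj-suc : ∀ {v u : Fin N} → Adj G (suc v) (suc u) →
            suc (toℕ (suc v)) ≡ toℕ (suc u) ⊎ suc (toℕ (suc u)) ≡ toℕ (suc v)
  Adj-suc (inj₁ e)                     = inj₁ e
  Adj-suc (inj₂ (inj₁ e))              = inj₂ e
  Adj-suc (inj₂ (inj₂ (inj₁ (() , _))))
  Adj-suc (inj₂ (inj₂ (inj₂ (() , _))))

  mirror-adjacent : ∀ {i j} → i ≤ N → j ≤ N → suc i ≡ j ⊎ suc j ≡ i →
                    suc (mirror i) ≡ mirror j ⊎ suc (mirror j) ≡ mirror i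
  mirror-adjacent i≤N _ (inj₁ refl) = inj₂ (sym (mirror-suc i≤N))
  mirror-adjacent _ j≤N (inj₂ refl) = inj₁ (sym (mirror-suc j≤N))

  pebbling-weights : ∀ {i j} → 1 ≤ i → i ≤ N → j ≤ N → suc i ≡ j ⊎ suc j ≡ i →
                     (pathWeight k j ≤ 2 * pathWeight k i × pathWeight k (mirror j) ≤ 2 * pathWeight k (mirror i))
                     ⊎ (i ≡ k × j ≡ suc k) ⊎ (i ≡ suc k × j ≡ k)
  pebbling-weights 1≤i i≤N j≤N i~j
    with pathWeight-adjacent {k} 1≤i i~j
       | pathWeight-adjacent {k} (1≤mirror i≤N) (mirror-adjacent i≤N j≤N i~j)
  ... | inj₂ (i≡1+k , j≡k) | _     = inj₂ (inj₂ (i≡1+k , j≡k))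
  ... | inj₁ _ | inj₂ (mi≡1+k , mj≡k) =
    inj₂ (inj₁ (trans (mirror-swap (≤-trans i≤N (n≤1+n N)) mi≡1+k) mirror-1+k ,
                trans (mirror-swap (≤-trans j≤N (n≤1+n N)) mj≡k) mirror-k))
  ... | inj₁ a | inj₁ b = inj₁ (a , b)

  rubbling-weights-between : ∀ {i} → 1 ≤ i → suc (suc i) ≤ N →
                             pathWeight k (suc i) ≤ pathWeight k i ×
                             pathWeight k (mirror (suc i)) ≤ pathWeight k (mirror (suc (suc i)))
  rubbling-weights-between {i} 1≤i i+2≤N =
    pathWeight-antitone 1≤i ,
    ≤-trans (≤-reflexive (cong (pathWeight k) (mirror-suc (≤-trans (n≤1+n _) i+2≤N))))
            (pathWeight-antitone (1≤mirror i+2≤N))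

  rubbling-weights : ∀ {i i′ l} → 1 ≤ i → 1 ≤ i′ → i ≤ N → i′ ≤ N → i ≢ i′ →
                     suc i ≡ l ⊎ suc l ≡ i → suc i′ ≡ l ⊎ suc l ≡ i′ →
                     pathWeight k l ≤ pathWeight k i + pathWeight k i′ ×
                     pathWeight k (mirror l) ≤ pathWeight k (mirror i) + pathWeight k (mirror i′)
  rubbling-weights _ _ _ _ i≢i′ (inj₁ refl) (inj₁ e) = ⊥-elim (i≢i′ (suc-injective (sym e)))
  rubbling-weights _ _ _ _ i≢i′ (inj₂ e) (inj₂ refl) = ⊥-elim (i≢i′ (sym e))
  rubbling-weights {i} {i′} 1≤i _ _ i′≤N _ (inj₁ refl) (inj₂ refl) =
    let a , b = rubbling-weights-between 1≤i i′≤N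
    in ≤-trans a (m≤m+n _ (pathWeight k i′)) , ≤-trans b (m≤n+m _ (pathWeight k (mirror i)))
  rubbling-weights {i} {i′} _ 1≤i′ i≤N _ _ (inj₂ refl) (inj₁ refl) =
    let a , b = rubbling-weights-between 1≤i′ i≤N
    in ≤-trans a (m≤n+m _ (pathWeight k i)) , ≤-trans b (m≤m+n _ (pathWeight k (mirror i′)))

  module LowerBound {A B : ℕ} (3[A+B]+2≤7H : 3 * (A + B) + 2 ≤ 7 * H)
                    (2H≤3B+3 : 2 * H ≤ 3 * B + 3) (3B+1≤2H : 3 * B + 1 ≤ 2 * H) where

    -- s and t absorb the pebbling moves across the far edge in the two directions.
    record Slack (X Y : ℕ) : Set where
      constructor slack
      field
        s t    : ℕ
        boundA : X + 2 * s ≤ A + t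
        boundB : Y + 2 * t ≤ B + s

    Slack-mono : ∀ {X Y X′ Y′} → X′ ≤ X → Y′ ≤ Y → Slack X Y → Slack X′ Y′
    Slack-mono X′≤X Y′≤Y (slack s t hX hY) =
      slack s t (≤-trans (+-monoˡ-≤ (2 * s) X′≤X) hX) (≤-trans (+-monoˡ-≤ (2 * t) Y′≤Y) hY)

    Slack-crossAB : ∀ {X Y X′ Y′} → X′ + 2 * 1 ≡ X + 0 → Y′ + 2 * 0 ≡ Y + 1 → Slack X Y → Slack X′ Y′
    Slack-crossAB {X} {Y} {X′} {Y′} e₁ e₂ (slack s t hX hY) =
      let hX′ , hY′ = cross-slack {A = A} {B = B} {s = s} {t = t}
                                  (trans e₁ (+-identityʳ X)) (trans (sym (+-identityʳ Y′)) e₂) hX hY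
      in slack (suc s) t hX′ hY′

    Slack-crossBA : ∀ {X Y X′ Y′} → X′ + 2 * 0 ≡ X + 1 → Y′ + 2 * 1 ≡ Y + 0 → Slack X Y → Slack X′ Y′
    Slack-crossBA {X} {Y} {X′} {Y′} e₁ e₂ (slack s t hX hY) =
      let hY′ , hX′ = cross-slack {A = B} {B = A} {s = t} {t = s}
                                  (trans e₂ (+-identityʳ Y)) (trans (sym (+-identityʳ X′)) e₁) hY hX
      in slack s (suc t) hX′ hY′

    Slack-starved : ∀ {X Y} → Slack X Y → 2 * H ≤ X ⊎ 2 * H ≤ Y ⊎ (H ≤ X × H ≤ Y) → ⊥
    Slack-starved (slack s t hX hY) =
      slack-infeasible {A = A} {B = B} {s = s} {t = t} 3[A+B]+2≤7H 2H≤3B+3 3B+1≤2H hX hY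

    *H≤weight : ∀ ω (q : Dist G) {y c} → ω y ≡ H → c ≤ q y → c * H ≤ weight ω q
    *H≤weight ω q {c = c} ωy≡H c≤qy = subst (λ h → c * h ≤ weight ω q) ωy≡H (*≤weight ω q c≤qy)

    H≤weight : ∀ ω (q : Dist G) {y} → ω y ≡ H → 1 ≤ q y → H ≤ weight ω q
    H≤weight ω q {y} ωy≡H 1≤qy = subst (_≤ weight ω q) (*-identityˡ H) (*H≤weight ω q {y} ωy≡H 1≤qy)

    pebbling-onto-target : ∀ {q : Dist G} {v} → Slack (weight ωa q) (weight ωb q) →
                           Adj G v zero → 2 ≤ q v → ⊥
    pebbling-onto-target {q} {v} sl v~0 2≤qv with Adj-zero v~0
    ... | inj₁ v≡1 = Slack-starved sl (inj₁ (*H≤weight ωa q {y = v} (ωa-at-1 v≡1) 2≤qv))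
    ... | inj₂ v≡N = Slack-starved sl (inj₂ (inj₁ (*H≤weight ωb q {y = v} (ωb-at-N v≡N) 2≤qv)))

    rubbling-onto-target : ∀ {q : Dist G} {v w} → Slack (weight ωa q) (weight ωb q) → v ≢ w →
                           Adj G v zero → Adj G w zero → 1 ≤ q v → 1 ≤ q w → ⊥
    rubbling-onto-target {q} {v} {w} sl v≢w v~0 w~0 1≤qv 1≤qw with Adj-zero v~0 | Adj-zero w~0
    ... | inj₁ v≡1 | inj₁ w≡1 = v≢w (toℕ-injective (trans v≡1 (sym w≡1)))
    ... | inj₂ v≡N | inj₂ w≡N = v≢w (toℕ-injective (trans v≡N (sym w≡N)))
    ... | inj₁ v≡1 | inj₂ w≡N = Slack-starved sl
      (inj₂ (inj₂ (H≤weight ωa q {v} (ωa-at-1 v≡1) 1≤qv , H≤weight ωb q {w} (ωb-at-N w≡N) 1≤qw)))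
    ... | inj₂ v≡N | inj₁ w≡1 = Slack-starved sl
      (inj₂ (inj₂ (H≤weight ωa q {w} (ωa-at-1 w≡1) 1≤qw , H≤weight ωb q {v} (ωb-at-N v≡N) 1≤qv)))

    Slack-pebble : ∀ {q : Dist G} {v u : Fin N} → Slack (weight ωa q) (weight ωb q) → Adj G (suc v) (suc u) →
                   2 ≤ q (suc v) →
                   Slack (weight ωa (pebble q (suc v) (suc u))) (weight ωb (pebble q (suc v) (suc u)))
    Slack-pebble {q} {v} {u} sl v~u 2≤qv
      with pebbling-weights (s≤s z≤n) (toℕ≤N (suc v)) (toℕ≤N (suc u)) (Adj-suc v~u)
    ... | inj₁ (a , b) = Slack-mono (balance⇒≤ (weight-pebble ωa q (suc u) 2≤qv) a)
                                    (balance⇒≤ (weight-pebble ωb q (suc u) 2≤qv) b) sl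
    ... | inj₂ (inj₁ (v≡k , u≡1+k)) =
      Slack-crossAB (balance-at (weight-pebble ωa q (suc u) 2≤qv) (ωa-at-k v≡k) (ωa-at-1+k u≡1+k))
                    (balance-at (weight-pebble ωb q (suc u) 2≤qv) (ωb-at-k v≡k) (ωb-at-1+k u≡1+k)) sl
    ... | inj₂ (inj₂ (v≡1+k , u≡k)) =
      Slack-crossBA (balance-at (weight-pebble ωa q (suc u) 2≤qv) (ωa-at-1+k v≡1+k) (ωa-at-k u≡k))
                    (balance-at (weight-pebble ωb q (suc u) 2≤qv) (ωb-at-1+k v≡1+k) (ωb-at-k u≡k)) sl

    Slack-rubble : ∀ {q : Dist G} {v w u : Fin N} → Slack (weight ωa q) (weight ωb q) → suc v ≢ suc w →
                   Adj G (suc v) (suc u) → Adj G (suc w) (suc u) → 1 ≤ q (suc v) → 1 ≤ q (suc w) →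
                   Slack (weight ωa (rubble q (suc v) (suc w) (suc u)))
                         (weight ωb (rubble q (suc v) (suc w) (suc u)))
    Slack-rubble {q} {v} {w} {u} sl v≢w v~u w~u 1≤qv 1≤qw =
      let a , b = rubbling-weights (s≤s z≤n) (s≤s z≤n) (toℕ≤N (suc v)) (toℕ≤N (suc w))
                                   (v≢w ∘ toℕ-injective)
                                   (Adj-suc v~u) (Adj-suc w~u)
      in Slack-mono (balance⇒≤ (weight-rubble ωa q (suc u) v≢w 1≤qv 1≤qw) a)
                    (balance⇒≤ (weight-rubble ωb q (suc u) v≢w 1≤qv 1≤qw) b) sl

    Potential : Dist G → Set
    Potential q = q zero ≡ 0 × Slack (weight ωa q) (weight ωb q)

    Potential-move : ∀ {q q′} → Potential q → Move G q q′ → Potential q′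
    Potential-move (q0≡0 , _) (Move.pebbling zero _ _ 2≤q0) =
      ⊥-elim (1+n≰n (≤-trans (s≤s z≤n) (subst (2 ≤_) q0≡0 2≤q0)))
    Potential-move {q} (_ , sl) (Move.pebbling (suc v) zero v~0 2≤qv) =
      ⊥-elim (pebbling-onto-target {q} sl v~0 2≤qv)
    Potential-move {q} (q0≡0 , sl) (Move.pebbling (suc v) (suc u) v~u 2≤qv) =
      trans (+-identityʳ (q zero)) q0≡0 , Slack-pebble {q} sl v~u 2≤qv
    Potential-move (q0≡0 , _) (Move.strict zero _ _ _ _ _ 1≤q0 _) =
      ⊥-elim (1+n≰n (subst (1 ≤_) q0≡0 1≤q0))
    Potential-move (q0≡0 , _) (Move.strict (suc _) zero _ _ _ _ _ 1≤q0) =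
      ⊥-elim (1+n≰n (subst (1 ≤_) q0≡0 1≤q0))
    Potential-move {q} (_ , sl) (Move.strict (suc v) (suc w) zero v≢w v~0 w~0 1≤qv 1≤qw) =
      ⊥-elim (rubbling-onto-target {q} sl v≢w v~0 w~0 1≤qv 1≤qw)
    Potential-move {q} (q0≡0 , sl) (Move.strict (suc v) (suc w) (suc u) v≢w v~u w~u 1≤qv 1≤qw) =
      trans (+-identityʳ (q zero)) q0≡0 , Slack-rubble {q} sl v≢w v~u w~u 1≤qv 1≤qw

    Potential-moves : ∀ {q q′} → Potential q → Star (Move G) q q′ → Potential q′
    Potential-moves pq ε        = pq
    Potential-moves pq (m ◅ ms) = Potential-moves (Potential-move pq m) ms

    farDistribution : ℕ → ℕ → Dist G
    farDistribution A′ B′ y = pt farA A′ y + pt farB B′ y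

    weight-farDistribution : ∀ ω A′ B′ → weight ω (farDistribution A′ B′) ≡ A′ * ω farA + B′ * ω farB
    weight-farDistribution ω A′ B′ =
      trans (weight-+ ω (pt farA A′) (pt farB B′)) (cong₂ _+_ (weight-pt ω farA A′) (weight-pt ω farB B′))

    size-farDistribution : ∀ A′ B′ → size G (farDistribution A′ B′) ≡ A′ + B′
    size-farDistribution A′ B′ = begin
      size G (farDistribution A′ B′)              ≡⟨ size≡sum G (farDistribution A′ B′) ⟩
      sum (farDistribution A′ B′)                 ≡⟨ *-identityʳ _ ⟨
      sum (farDistribution A′ B′) * 1             ≡⟨ weight-const 1 (farDistribution A′ B′) ⟨
      weight (λ _ → 1) (farDistribution A′ B′)    ≡⟨ weight-farDistribution (λ _ → 1) A′ B′ ⟩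
      A′ * 1 + B′ * 1                             ≡⟨ cong₂ _+_ (*-identityʳ A′) (*-identityʳ B′) ⟩
      A′ + B′                                     ∎
      where open ≡-Reasoning

    Potential-farDistribution : ∀ {A′ B′} → A′ ≤ A → B′ ≤ B → Potential (farDistribution A′ B′)
    Potential-farDistribution {A′} {B′} A′≤A B′≤B =
      cong₂ _+_ (pt-other A′ (λ 0≡farA → 0≢1+n (trans (cong toℕ 0≡farA) toℕ-farA)))
                (pt-other B′ (λ 0≡farB → 0≢1+n (trans (cong toℕ 0≡farB) toℕ-farB))) ,
      slack 0 0 (+-monoˡ-≤ 0 (≤-trans (≤-reflexive weightA) A′≤A))
                (+-monoˡ-≤ 0 (≤-trans (≤-reflexive weightB) B′≤B))
      where
      open ≡-Reasoning
      weightA : weight ωa (farDistribution A′ B′) ≡ A′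
      weightA = begin
        weight ωa (farDistribution A′ B′)
          ≡⟨ weight-farDistribution ωa A′ B′ ⟩
        A′ * ωa farA + B′ * ωa farB
          ≡⟨ cong₂ (λ a b → A′ * a + B′ * b) (ωa-at-k toℕ-farA) (ωa-at-1+k toℕ-farB) ⟩
        A′ * 1 + B′ * 0
          ≡⟨ cong₂ _+_ (*-identityʳ A′) (*-zeroʳ B′) ⟩
        A′ + 0
          ≡⟨ +-identityʳ A′ ⟩
        A′ ∎
      weightB : weight ωb (farDistribution A′ B′) ≡ B′
      weightB = begin
        weight ωb (farDistribution A′ B′)
          ≡⟨ weight-farDistribution ωb A′ B′ ⟩
        A′ * ωb farA + B′ * ωb farB
          ≡⟨ cong₂ (λ a b → A′ * a + B′ * b) (ωb-at-k toℕ-farA) (ωb-at-1+k toℕ-farB) ⟩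
        A′ * 0 + B′ * 1
          ≡⟨ cong₂ _+_ (*-zeroʳ A′) (*-identityʳ B′) ⟩
        B′ ∎

    unsolvable : ∀ {A′ B′} → A′ ≤ A → B′ ≤ B → ¬ Solvable G (A′ + B′)
    unsolvable {A′} {B′} A′≤A B′≤B solvable =
      let q , moves , 1≤q0 = solvable (farDistribution A′ B′) (size-farDistribution A′ B′) zero
          q0≡0 , _ = Potential-moves (Potential-farDistribution A′≤A B′≤B) moves
      in 1+n≰n (subst (1 ≤_) q0≡0 1≤q0)

  -- ωa + ωb ≥ 2 at every vertex except the target and the far edge, where it is 1 and the
  -- indicator makes up the difference.
  coverWeight : Fin (suc N) → ℕ
  coverWeight y = ωa y + ωb y + pt farA 1 y + pt farB 1 y

  weight-coverWeight : ∀ q → weight coverWeight q ≡ weight ωa q + weight ωb q + q farA + q farB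
  weight-coverWeight q = begin
    weight coverWeight q
      ≡⟨ weight-+ω (λ y → ωa y + ωb y + pt farA 1 y) (pt farB 1) q ⟩
    weight (λ y → ωa y + ωb y + pt farA 1 y) q + weight (pt farB 1) q
      ≡⟨ cong₂ _+_ (weight-+ω (λ y → ωa y + ωb y) (pt farA 1) q) (weight-indicator q farB) ⟩
    weight (λ y → ωa y + ωb y) q + weight (pt farA 1) q + q farB
      ≡⟨ cong₂ (λ a b → a + b + q farB) (weight-+ω ωa ωb q) (weight-indicator q farA) ⟩
    weight ωa q + weight ωb q + q farA + q farB ∎
    where open ≡-Reasoning

  farA-covered : 2 ≤ coverWeight farA
  farA-covered = begin
    2                          ≡⟨ cong₂ _+_ (ωa-at-k toℕ-farA) (pt-self farA 1) ⟨
    ωa farA + pt farA 1 farA   ≤⟨ +-monoˡ-≤ (pt farA 1 farA) (m≤m+n (ωa farA) (ωb farA)) ⟩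
    ωa farA + ωb farA + pt farA 1 farA ≤⟨ m≤m+n _ (pt farB 1 farA) ⟩
    coverWeight farA           ∎
    where open ≤-Reasoning

  farB-covered : 2 ≤ coverWeight farB
  farB-covered = begin
    2                          ≡⟨ cong₂ _+_ (ωb-at-1+k toℕ-farB) (pt-self farB 1) ⟨
    ωb farB + pt farB 1 farB   ≤⟨ +-monoˡ-≤ (pt farB 1 farB) (≤-trans (m≤n+m (ωb farB) (ωa farB))
                                                                      (m≤m+n _ (pt farA 1 farB))) ⟩
    coverWeight farB           ∎
    where open ≤-Reasoning

  coverage : ∀ y → y ≢ zero → 2 ≤ coverWeight y
  coverage zero y≢0 = ⊥-elim (y≢0 refl)
  coverage y@(suc _) _ with <-cmp (toℕ y) k
  ... | tri< y<k _ _ =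
    ≤-trans (2≤pathWeight (s≤s z≤n) y<k) (≤-trans (m≤m+n _ _) (≤-trans (m≤m+n _ _) (m≤m+n _ _)))
  ... | tri≈ _ y≡k _ =
    subst (λ z → 2 ≤ coverWeight z) (toℕ-injective (trans toℕ-farA (sym y≡k))) farA-covered
  ... | tri> _ _ k<y with toℕ y ≟ℕ suc k
  ...   | yes y≡1+k =
    subst (λ z → 2 ≤ coverWeight z) (toℕ-injective (trans toℕ-farB (sym y≡1+k))) farB-covered
  ...   | no  y≢1+k =
    ≤-trans (2≤pathWeight (1≤mirror (toℕ≤N y)) my<k)
            (≤-trans (m≤n+m _ (ωa y)) (≤-trans (m≤m+n _ _) (m≤m+n _ _)))
    where
    my<k : mirror (toℕ y) < k
    my<k = s≤s (≤-trans (∸-monoʳ-≤ (suc N) (≤∧≢⇒< k<y (≢-sym y≢1+k))) (≤-reflexive (m+n∸n≡m k′ k)))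

  2*size≤coverWeight : ∀ (q : Dist G) → q zero ≡ 0 →
                       2 * size G q ≤ weight ωa q + weight ωb q + q farA + q farB
  2*size≤coverWeight q q0≡0 = begin
    2 * size G q             ≡⟨ *-comm 2 (size G q) ⟩
    size G q * 2             ≡⟨ cong (_* 2) (size≡sum G q) ⟩
    sum q * 2                ≡⟨ weight-const 2 q ⟨
    weight (λ _ → 2) q       ≤⟨ sum-mono-≤ termwise ⟩
    weight coverWeight q     ≡⟨ weight-coverWeight q ⟩
    weight ωa q + weight ωb q + q farA + q farB ∎
    where
    open ≤-Reasoning
    termwise : ∀ y → q y * 2 ≤ q y * coverWeight y
    termwise zero    rewrite q0≡0 = z≤n
    termwise (suc y) = *-monoʳ-≤ (q (suc y)) (coverage (suc y) λ ())

  a₁ b₁ : Fin (suc N)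
  a₁ = vertexAt 1
  b₁ = vertexAt N

  toℕ-a₁ : toℕ a₁ ≡ 1
  toℕ-a₁ = toℕ-vertexAt (≤-trans (s≤s z≤n) k≤N)

  a₁~0 : Adj G a₁ zero
  a₁~0 = inj₂ (inj₁ (sym toℕ-a₁))

  b₁~0 : Adj G b₁ zero
  b₁~0 = inj₂ (inj₂ (inj₂ (refl , cong suc (toℕ-vertexAt ≤-refl))))

  a₁≢b₁ : a₁ ≢ b₁
  a₁≢b₁ a₁≡b₁ =
    <⇒≢ (≤-trans (s≤s (s≤s z≤n)) k<N) (trans (sym toℕ-a₁) (trans (cong toℕ a₁≡b₁) (toℕ-vertexAt ≤-refl)))

  finalMove : ∀ {ma mb} → FinalMove ma mb → (q : Dist G) → ma ≤ q a₁ → mb ≤ q b₁ → Reachable G q zero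
  finalMove pebbleFromA    q 2≤qa₁ _     = _ , Move.pebbling a₁ zero a₁~0 2≤qa₁ ◅ ε , m≤n+m 1 _
  finalMove pebbleFromB    q _     2≤qb₁ = _ , Move.pebbling b₁ zero b₁~0 2≤qb₁ ◅ ε , m≤n+m 1 _
  finalMove rubbleFromBoth q 1≤qa₁ 1≤qb₁ =
    _ , Move.strict a₁ b₁ zero a₁≢b₁ a₁~0 b₁~0 1≤qa₁ 1≤qb₁ ◅ ε , m≤n+m 1 _

  ωb-vanishes : ∀ {y} → toℕ y ≤ k → ωb y ≡ 0
  ωb-vanishes y≤k = pathWeight-beyond (≤-trans (≤-reflexive (sym mirror-k)) (∸-monoʳ-≤ (suc N) y≤k))

  weight-ωb-unchanged : ∀ {q q′ : Dist G} → (∀ y → OffPrefix pathA k y → q′ y ≡ q y) →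
                        weight ωb q′ ≡ weight ωb q
  weight-ωb-unchanged {q} {q′} q′≗q = sum-cong-≗ termwise
    where
    termwise : ∀ y → q′ y * ωb y ≡ q y * ωb y
    termwise y with k <? toℕ y
    ... | yes k<y = cong (_* ωb y) (q′≗q y (inj₂ k<y))
    ... | no  k≮y rewrite ωb-vanishes {y} (≮⇒≥ k≮y) = trans (*-zeroʳ (q′ y)) (sym (*-zeroʳ (q y)))

  gather : ∀ {ma mb} → FinalMove ma mb → (q : Dist G) →
           ma * H ≤ weight ωa q → mb * H ≤ weight ωb q → Reachable G q zero
  gather {ma} {mb} fm q maH≤X mbH≤Y =
    let q₂ , q⇒q₂ , ma≤q₂a₁ , q₂≗q  = collect pathA k′ ≤-refl ma maH≤X
        q₃ , q₂⇒q₃ , mb≤q₃b₁ , q₃≗q₂ =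
          collect pathB k′ ≤-refl mb (≤-trans mbH≤Y (≤-reflexive (sym (weight-ωb-unchanged q₂≗q))))
    in reachable-◅◅ (q⇒q₂ ◅◅ q₂⇒q₃)
                    (finalMove fm q₃ (subst (ma ≤_) (sym (q₃≗q₂ a₁ a₁-offB)) ma≤q₂a₁) mb≤q₃b₁)
    where
    a₁-offB : OffPrefix pathB k a₁
    a₁-offB = inj₂ (subst (k <_) (cong mirror (sym toℕ-a₁)) k<N)

  farA~farB : Adj G farA farB
  farA~farB = inj₁ (trans (cong suc toℕ-farA) (sym toℕ-farB))

  farB~farA : Adj G farB farA
  farB~farA = inj₂ (inj₁ (trans (cong suc toℕ-farA) (sym toℕ-farB)))

  execute : ∀ (q : Dist G) → Plan H (weight ωa q) (weight ωb q) (q farA) (q farB) → Reachable G q zero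
  execute q (shiftAB t fm 2t≤ea maH+2t≤X mbH≤Y+t) =
    let q₁ , q⇒q₁ , bal = transfer farA~farB t 2t≤ea
        X₁+2t≡X = weight-transfer-source ωa q q₁ (ωa-at-k toℕ-farA) (ωa-at-1+k toℕ-farB) bal
        Y₁≡Y+t  = weight-transfer-target ωb q q₁ (ωb-at-k toℕ-farA) (ωb-at-1+k toℕ-farB) bal
    in reachable-◅◅ q⇒q₁ (gather fm q₁
         (+-cancelʳ-≤ (2 * t) _ _ (≤-trans maH+2t≤X (≤-reflexive (sym X₁+2t≡X))))
         (≤-trans mbH≤Y+t (≤-reflexive (sym Y₁≡Y+t))))
  execute q (shiftBA t fm 2t≤eb maH≤X+t mbH+2t≤Y) =
    let q₁ , q⇒q₁ , bal = transfer farB~farA t 2t≤eb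
        X₁≡X+t  = weight-transfer-target ωa q q₁ (ωa-at-1+k toℕ-farB) (ωa-at-k toℕ-farA) bal
        Y₁+2t≡Y = weight-transfer-source ωb q q₁ (ωb-at-1+k toℕ-farB) (ωb-at-k toℕ-farA) bal
    in reachable-◅◅ q⇒q₁ (gather fm q₁
         (≤-trans maH≤X+t (≤-reflexive (sym X₁≡X+t)))
         (+-cancelʳ-≤ (2 * t) _ _ (≤-trans mbH+2t≤Y (≤-reflexive (sym Y₁+2t≡Y)))))

  reach-zero : ∀ {m} (q : Dist G) → size G q ≡ m → 7 * H ≤ 3 * m + 1 → Reachable G q zero
  reach-zero {m} q refl 7H≤3m+1 with 1 ≤? q zero
  ... | yes 1≤q0 = q , ε , 1≤q0
  ... | no  1≰q0 = execute q (plan {m = m} 7H≤3m+1 (2*size≤coverWeight q (n<1⇒n≡0 (≰⇒> 1≰q0)))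
                                   (unit≤weight ωa (ωa-at-k toℕ-farA)) (unit≤weight ωb (ωb-at-1+k toℕ-farB)))
    where
    unit≤weight : ∀ ω {y} → ω y ≡ 1 → q y ≤ weight ω q
    unit≤weight ω {y} ωy≡1 =
      subst (_≤ weight ω q) (trans (cong (q y *_) ωy≡1) (*-identityʳ (q y))) (*≤weight ω q ≤-refl)

  solvable : ∀ m → 7 * H ≤ 3 * m + 1 → Solvable G m
  solvable m 7H≤3m+1 p size≡m x =
    rotate-induction Target (λ q size≡m → reach-zero q size≡m 7H≤3m+1) step x p size≡m
    where
    Target : Fin (suc N) → Set
    Target x = (q : Dist G) → size G q ≡ m → Reachable G q x
    step : ∀ y → Target y → Target (rotate y)
    step y reach q size≡m =
      reachable-apply (rotation (≤-trans (s≤s z≤n) k≤N)) (λ _ → refl)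
                      (reach (q ∘ rotate) (trans (size-rotate q) size≡m))

  open Threshold H (m^n>0 2 k′)

  rubblingNumber : IsRubblingNumber G (F + 1)
  rubblingNumber = solvable (F + 1) 7H≤3[F+1]+1 , minimal
    where
    minimal : ∀ m → Solvable G m → F + 1 ≤ m
    minimal m solvable-m with m ≤? F
    ... | no  m≰F = ≤-trans (≤-reflexive (+-comm F 1)) (≰⇒> m≰F)
    ... | yes m≤F = ⊥-elim $ LowerBound.unsolvable 3[A+B]+2≤7H 2H≤3B+3 3B+1≤2H
                               (∸-monoˡ-≤ B m≤F) (m⊓n≤m B m) (subst (Solvable G) split solvable-m)
      where
      split : m ≡ (m ∸ B) + (B ⊓ m)
      split = trans (sym (m⊓n+n∸m≡n B m)) (+-comm (B ⊓ m) (m ∸ B))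

mainTheorem12 : (k : ℕ) → 1 ≤ k →
    IsRubblingNumber (Cycle (2 * k + 1)) ((7 * 2 ^ (k ∸ 1) ∸ 2) / 3 + 1)
mainTheorem12 zero    ()
mainTheorem12 (suc k′) _ =
  subst (λ c → IsRubblingNumber (Cycle c) ((7 * 2 ^ k′ ∸ 2) / 3 + 1)) order (OddCycle.rubblingNumber k′)
  where
  order : suc (suc k′ + suc k′) ≡ 2 * suc k′ + 1
  order = solve (k′ ∷ [])
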